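{- If $X,Y\subseteq B^n$ are negation-similar, then $s(X)=s(Y)$.
   Context: $B=\{0,1\}$. A comparator $[i,j]$ replaces $x_i$ by $\min(x_i,x_j)$ and $x_j$ by $\max(x_i,x_j)$; an exchange $(i,j)$ swaps entries $i,j$. A comparator network on $n$ channels is a finite sequence of comparators and exchanges applied left to right; its size is its number of comparators. For $X\subseteq B^n$, $s(X)$ is the minimal size of a comparator network whose output on every $x\in X$ is sorted (nondecreasing). For $x\in B^n$, $x^{\mathbf b}$ is its elementwise Boolean negation, and $X^{\mathbf b}=\{x^{\mathbf b}\mid x\in X\}$. $X$ and $Y$ are negation-similar if $X=Y$ or $X=Y^{\mathbf b}$. -}

module Defs where

open import Data.Bool using (Bool; true; false; not; _∧_; _∨_)
open import Data.Nat using (ℕ; zero; suc; _≤_)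
open import Data.Fin using (Fin)
open import Data.Vec using (Vec; []; _∷_; lookup; map)
open import Data.Vec.Functional as VF using ()
open import Data.List using (List; []; _∷_)
open import Data.Fin using (_≟_)
open import Relation.Nullary using (yes; no)
open import Relation.Unary using (Pred)
open import Data.Product using (Σ; _×_; _,_)
open import Data.Sum using (_⊎_)
open import Function.Bundles using (_⇔_)
open import Level using (0ℓ)

-- B = Bool (false = 0, true = 1); order false < true.
-- min and max on B
minB maxB : Bool → Bool → Bool
minB = _∧_
maxB = _∨_

data Gate (n : ℕ) : Set where
  comp : Fin n → Fin n → Gate n
  exch : Fin n → Fin n → Gate n

Network : ℕ → Set
Network n = List (Gate n)

applyGate : {n : ℕ} → Gate n → Vec Bool n → Vec Bool n
applyGate (comp i j) x = Data.Vec.tabulate f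
  where
  f : _ → Bool
  f k with k ≟ i | k ≟ j
  ... | yes _ | _     = minB (lookup x i) (lookup x j)
  ... | no _  | yes _ = maxB (lookup x i) (lookup x j)
  ... | no _  | no _  = lookup x k
applyGate (exch i j) x = Data.Vec.tabulate f
  where
  f : _ → Bool
  f k with k ≟ i | k ≟ j
  ... | yes _ | _     = lookup x j
  ... | no _  | yes _ = lookup x i
  ... | no _  | no _  = lookup x k

run : {n : ℕ} → Network n → Vec Bool n → Vec Bool n
run []       x = x
run (g ∷ gs) x = run gs (applyGate g x)

size : {n : ℕ} → Network n → ℕ
size []            = 0
size (comp _ _ ∷ gs) = suc (size gs)
size (exch _ _ ∷ gs) = size gs

data _≤B_ : Bool → Bool → Set where
  f≤b : ∀ {b} → false ≤B b
  t≤t : true ≤B true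

data Sorted : {n : ℕ} → Vec Bool n → Set where
  []  : Sorted []
  [_] : ∀ b → Sorted (b ∷ [])
  _∷_ : ∀ {n a b} {xs : Vec Bool n} → a ≤B b → Sorted (b ∷ xs) → Sorted (a ∷ b ∷ xs)

Subset : ℕ → Set₁
Subset n = Pred (Vec Bool n) 0ℓ

Sorts : {n : ℕ} → Network n → Subset n → Set
Sorts {n} N X = ∀ (x : Vec Bool n) → X x → Sorted (run N x)

IsS : {n : ℕ} → Subset n → ℕ → Set
IsS {n} X k = Σ (Network n) (λ N → Sorts N X × size N ≡ k)
            × (∀ (N : Network n) → Sorts N X → k ≤ size N)
  where open import Relation.Binary.PropositionalEquality using (_≡_)

negate : {n : ℕ} → Vec Bool n → Vec Bool n
negate = map not

negSet : {n : ℕ} → Subset n → Subset n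
negSet X x = Σ (Vec Bool _) (λ y → X y × negate y ≡ x)
  where open import Relation.Binary.PropositionalEquality using (_≡_)

_≐_ : {n : ℕ} → Subset n → Subset n → Set
X ≐ Y = ∀ x → X x ⇔ Y x

NegSimilar : {n : ℕ} → Subset n → Subset n → Set
NegSimilar X Y = (X ≐ Y) ⊎ (X ≐ negSet Y)

{-# OPTIONS --safe #-}
-- Reversing the direction of every comparator of a network N gives a network that commutes with
-- negation (by De Morgan, ¬ min(a,b) = max(¬a,¬b)), so on the input xᵇ it outputs the negation of
-- N's output on x, a nonincreasing vector. Appending a comparator-free network that reverses the
-- channels makes it sorted. This size-preserving transformation maps sorters of X to sorters of Xᵇ
-- and back.
module Submission where

open import Defs
open import Data.Bool using (Bool; true; false; not; _∧_; _∨_)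
open import Data.Bool.Properties using (∨-comm; ∧-comm; ∧-idem; not-involutive; ∨-∧-booleanAlgebra)
open import Algebra.Lattice.Properties.BooleanAlgebra ∨-∧-booleanAlgebra using (deMorgan₁; deMorgan₂)
open import Data.Fin using (Fin; zero; suc; _≟_)
open import Data.List as List using ([]; _∷_; _++_)
open import Data.Nat using (ℕ; zero; suc; _+_; _≤_)
open import Data.Nat.Properties using (+-identityʳ)
open import Data.Product using (_,_)
open import Data.Sum using (inj₁; inj₂)
open import Data.Vec using (Vec; []; _∷_; lookup; replicate; reverse; _∷ʳ_)
open import Data.Vec.Properties using (lookup∘tabulate; lookup-map; map-replicate; reverse-∷)
open import Data.Vec.Relation.Binary.Pointwise.Extensional using (ext; extensional⇒inductive)
open import Data.Vec.Relation.Binary.Pointwise.Inductive using (Pointwise-≡⇒≡)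
open import Function using (id; _∘_; _∋_)
open import Function.Bundles using (_⇔_; mk⇔; module Equivalence)
open import Relation.Nullary using (yes; no; does)
open import Relation.Unary using (_⊆_)
open import Relation.Binary.PropositionalEquality
  using (_≡_; refl; sym; trans; cong; cong₂; subst; module ≡-Reasoning)

private
  variable
    n : ℕ

lookup-extensionality : {u v : Vec Bool n} → (∀ k → lookup u k ≡ lookup v k) → u ≡ v
lookup-extensionality h = Pointwise-≡⇒≡ (extensional⇒inductive (ext h))

-- The case split applyGate performs on channel k, with atI, atJ the outcomes of k ≟ i and k ≟ j.
select : (atI atJ onI onJ elsewhere : Bool) → Bool
select true  _     onI onJ elsewhere = onI
select false true  onI onJ elsewhere = onJ
select false false onI onJ elsewhere = elsewhere

lookup-comp : (i j : Fin n) (x : Vec Bool n) (k : Fin n) →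
  lookup (applyGate (comp i j) x) k ≡
  select (does (k ≟ i)) (does (k ≟ j)) (lookup x i ∧ lookup x j) (lookup x i ∨ lookup x j) (lookup x k)
-- The tabulated function is local to applyGate; it is named only through lookup∘tabulate.
lookup-comp i j x k
  rewrite (lookup (applyGate (comp i j) x) k ≡ _ ∋ lookup∘tabulate _ k)
  with k ≟ i | k ≟ j
... | yes _ | _     = refl
... | no _  | yes _ = refl
... | no _  | no _  = refl

lookup-exch : (i j : Fin n) (x : Vec Bool n) (k : Fin n) →
  lookup (applyGate (exch i j) x) k ≡
  select (does (k ≟ i)) (does (k ≟ j)) (lookup x j) (lookup x i) (lookup x k)
lookup-exch i j x k
  rewrite (lookup (applyGate (exch i j) x) k ≡ _ ∋ lookup∘tabulate _ k)
  with k ≟ i | k ≟ j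
... | yes _ | _     = refl
... | no _  | yes _ = refl
... | no _  | no _  = refl

run-++ : (N M : Network n) (x : Vec Bool n) → run (N ++ M) x ≡ run M (run N x)
run-++ []      M x = refl
run-++ (g ∷ N) M x = run-++ N M (applyGate g x)

size-++ : (N M : Network n) → size (N ++ M) ≡ size N + size M
size-++ []             M = refl
size-++ (comp _ _ ∷ N) M = cong suc (size-++ N M)
size-++ (exch _ _ ∷ N) M = size-++ N M

liftGate : Gate n → Gate (suc n)
liftGate (comp i j) = comp (suc i) (suc j)
liftGate (exch i j) = exch (suc i) (suc j)

liftNetwork : Network n → Network (suc n)
liftNetwork = List.map liftGate

applyGate-liftGate : (g : Gate n) (b : Bool) (x : Vec Bool n) →
  applyGate (liftGate g) (b ∷ x) ≡ b ∷ applyGate g x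
applyGate-liftGate (comp i j) b x = lookup-extensionality λ where
  zero    → lookup-comp (suc i) (suc j) (b ∷ x) zero
  (suc k) → trans (lookup-comp (suc i) (suc j) (b ∷ x) (suc k)) (sym (lookup-comp i j x k))
applyGate-liftGate (exch i j) b x = lookup-extensionality λ where
  zero    → lookup-exch (suc i) (suc j) (b ∷ x) zero
  (suc k) → trans (lookup-exch (suc i) (suc j) (b ∷ x) (suc k)) (sym (lookup-exch i j x k))

run-liftNetwork : (N : Network n) (b : Bool) (x : Vec Bool n) →
  run (liftNetwork N) (b ∷ x) ≡ b ∷ run N x
run-liftNetwork []      b x = refl
run-liftNetwork (g ∷ N) b x rewrite applyGate-liftGate g b x = run-liftNetwork N b (applyGate g x)

size-liftNetwork : (N : Network n) → size (liftNetwork N) ≡ size N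
size-liftNetwork []             = refl
size-liftNetwork (comp _ _ ∷ N) = cong suc (size-liftNetwork N)
size-liftNetwork (exch _ _ ∷ N) = size-liftNetwork N

applyGate-exch01 : (b c : Bool) (x : Vec Bool n) →
  applyGate (exch zero (suc zero)) (b ∷ c ∷ x) ≡ c ∷ b ∷ x
applyGate-exch01 b c x = lookup-extensionality λ where
  zero          → lookup-exch zero (suc zero) (b ∷ c ∷ x) zero
  (suc zero)    → lookup-exch zero (suc zero) (b ∷ c ∷ x) (suc zero)
  (suc (suc k)) → lookup-exch zero (suc zero) (b ∷ c ∷ x) (suc (suc k))

sinkHead : (n : ℕ) → Network (suc n)
sinkHead zero    = []
sinkHead (suc n) = exch zero (suc zero) ∷ liftNetwork (sinkHead n)

run-sinkHead : (b : Bool) (x : Vec Bool n) → run (sinkHead n) (b ∷ x) ≡ x ∷ʳ b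
run-sinkHead b []      = refl
run-sinkHead {suc n} b (c ∷ x)
  rewrite applyGate-exch01 b c x | run-liftNetwork (sinkHead n) c (b ∷ x) | run-sinkHead b x = refl

size-sinkHead : (n : ℕ) → size (sinkHead n) ≡ 0
size-sinkHead zero    = refl
size-sinkHead (suc n) = trans (size-liftNetwork (sinkHead n)) (size-sinkHead n)

reversal : (n : ℕ) → Network n
reversal zero    = []
reversal (suc n) = liftNetwork (reversal n) ++ sinkHead n

run-reversal : (x : Vec Bool n) → run (reversal n) x ≡ reverse x
run-reversal []              = refl
run-reversal {suc n} (b ∷ x) = begin
  run (liftNetwork (reversal n) ++ sinkHead n) (b ∷ x)
    ≡⟨ run-++ (liftNetwork (reversal n)) (sinkHead n) (b ∷ x) ⟩
  run (sinkHead n) (run (liftNetwork (reversal n)) (b ∷ x))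
    ≡⟨ cong (run (sinkHead n)) (run-liftNetwork (reversal n) b x) ⟩
  run (sinkHead n) (b ∷ run (reversal n) x)
    ≡⟨ run-sinkHead b (run (reversal n) x) ⟩
  run (reversal n) x ∷ʳ b
    ≡⟨ cong (_∷ʳ b) (run-reversal x) ⟩
  reverse x ∷ʳ b
    ≡⟨ reverse-∷ b x ⟨
  reverse (b ∷ x)
    ∎
  where open ≡-Reasoning

size-reversal : (n : ℕ) → size (reversal n) ≡ 0
size-reversal zero    = refl
size-reversal (suc n) rewrite size-++ (liftNetwork (reversal n)) (sinkHead n)
                            | size-liftNetwork (reversal n) | size-reversal n = size-sinkHead n

dualGate : Gate n → Gate n
dualGate (comp i j) = comp j i
dualGate (exch i j) = exch i j

dual : Network n → Network n
dual = List.map dualGate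

not-∧ : (a b : Bool) → not (a ∧ b) ≡ not b ∨ not a
not-∧ a b = trans (deMorgan₁ a b) (∨-comm (not a) (not b))

not-∨ : (a b : Bool) → not (a ∨ b) ≡ not b ∧ not a
not-∨ a b = trans (deMorgan₂ a b) (∧-comm (not a) (not b))

not-select : (p q u v w : Bool) → not (select p q u v w) ≡ select p q (not u) (not v) (not w)
not-select true  _     u v w = refl
not-select false true  u v w = refl
not-select false false u v w = refl

applyGate-dualGate : (g : Gate n) (x : Vec Bool n) →
  applyGate (dualGate g) (negate x) ≡ negate (applyGate g x)
applyGate-dualGate (comp i j) x = lookup-extensionality pointwise
  where
  pointwise : ∀ k → lookup (applyGate (comp j i) (negate x)) k ≡ lookup (negate (applyGate (comp i j) x)) k
  pointwise k
    rewrite lookup-comp j i (negate x) k | lookup-map k not (applyGate (comp i j) x) | lookup-comp i j x k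
          | lookup-map i not x | lookup-map j not x | lookup-map k not x
    with k ≟ i | k ≟ j
  ... | yes refl | yes refl = trans (∧-idem (not (lookup x k))) (cong not (sym (∧-idem (lookup x k))))
  ... | yes _    | no _     = sym (not-∧ (lookup x i) (lookup x j))
  ... | no _     | yes _    = sym (not-∨ (lookup x i) (lookup x j))
  ... | no _     | no _     = refl
applyGate-dualGate (exch i j) x = lookup-extensionality pointwise
  where
  pointwise : ∀ k → lookup (applyGate (exch i j) (negate x)) k ≡ lookup (negate (applyGate (exch i j) x)) k
  pointwise k
    rewrite lookup-exch i j (negate x) k | lookup-map k not (applyGate (exch i j) x) | lookup-exch i j x k
          | lookup-map i not x | lookup-map j not x | lookup-map k not x
    = sym (not-select (does (k ≟ i)) (does (k ≟ j)) _ _ _)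

run-dual : (N : Network n) (x : Vec Bool n) → run (dual N) (negate x) ≡ negate (run N x)
run-dual []      x = refl
run-dual (g ∷ N) x rewrite applyGate-dualGate g x = run-dual N (applyGate g x)

size-dual : (N : Network n) → size (dual N) ≡ size N
size-dual []             = refl
size-dual (comp _ _ ∷ N) = cong suc (size-dual N)
size-dual (exch _ _ ∷ N) = size-dual N

negate-involutive : (x : Vec Bool n) → negate (negate x) ≡ x
negate-involutive []      = refl
negate-involutive (b ∷ x) = cong₂ _∷_ (not-involutive b) (negate-involutive x)

≤B-refl : (b : Bool) → b ≤B b
≤B-refl false = f≤b
≤B-refl true  = t≤t

Sorted-replicate : (n : ℕ) (b : Bool) → Sorted (replicate n b)
Sorted-replicate zero          b = []
Sorted-replicate (suc zero)    b = [ b ]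
Sorted-replicate (suc (suc n)) b = ≤B-refl b ∷ Sorted-replicate (suc n) b

Sorted-tail : {b : Bool} {x : Vec Bool n} → Sorted (b ∷ x) → Sorted x
Sorted-tail [ _ ]   = []
Sorted-tail (_ ∷ s) = s

Sorted-∷ʳ-true : {x : Vec Bool n} → Sorted x → Sorted (x ∷ʳ true)
Sorted-∷ʳ-true []        = [ true ]
Sorted-∷ʳ-true [ false ] = f≤b ∷ [ true ]
Sorted-∷ʳ-true [ true ]  = t≤t ∷ [ true ]
Sorted-∷ʳ-true (p ∷ s)   = p ∷ Sorted-∷ʳ-true s

Sorted-true∷⇒replicate : {x : Vec Bool n} → Sorted (true ∷ x) → x ≡ replicate n true
Sorted-true∷⇒replicate [ true ]  = refl
Sorted-true∷⇒replicate (t≤t ∷ s) = cong (true ∷_) (Sorted-true∷⇒replicate s)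

replicate-∷ʳ : {A : Set} (n : ℕ) (a : A) → replicate n a ∷ʳ a ≡ a ∷ replicate n a
replicate-∷ʳ zero    a = refl
replicate-∷ʳ (suc n) a = cong (a ∷_) (replicate-∷ʳ n a)

reverse-replicate : {A : Set} (n : ℕ) (a : A) → reverse (replicate n a) ≡ replicate n a
reverse-replicate zero    a = refl
reverse-replicate (suc n) a = begin
  reverse (a ∷ replicate n a)  ≡⟨ reverse-∷ a (replicate n a) ⟩
  reverse (replicate n a) ∷ʳ a ≡⟨ cong (_∷ʳ a) (reverse-replicate n a) ⟩
  replicate n a ∷ʳ a           ≡⟨ replicate-∷ʳ n a ⟩
  a ∷ replicate n a            ∎
  where open ≡-Reasoning

Sorted-reverse-negate : {x : Vec Bool n} → Sorted x → Sorted (reverse (negate x))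
Sorted-reverse-negate {x = []} [] = []
Sorted-reverse-negate {x = false ∷ y} s =
  subst Sorted (sym (reverse-∷ true (negate y))) (Sorted-∷ʳ-true (Sorted-reverse-negate (Sorted-tail s)))
Sorted-reverse-negate {suc n} {x = true ∷ y} s = subst Sorted (sym all-false) (Sorted-replicate (suc n) false)
  where
  all-false : reverse (negate (true ∷ y)) ≡ replicate (suc n) false
  all-false rewrite Sorted-true∷⇒replicate s | map-replicate not true n = reverse-replicate (suc n) false

negationDual : Network n → Network n
negationDual {n} N = dual N ++ reversal n

size-negationDual : (N : Network n) → size (negationDual N) ≡ size N
size-negationDual {n} N = begin
  size (dual N ++ reversal n)       ≡⟨ size-++ (dual N) (reversal n) ⟩
  size (dual N) + size (reversal n) ≡⟨ cong₂ _+_ (size-dual N) (size-reversal n) ⟩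
  size N + 0                        ≡⟨ +-identityʳ (size N) ⟩
  size N                            ∎
  where open ≡-Reasoning

run-negationDual : (N : Network n) (y : Vec Bool n) →
  run (negationDual N) y ≡ reverse (negate (run N (negate y)))
run-negationDual {n} N y = begin
  run (dual N ++ reversal n) y               ≡⟨ run-++ (dual N) (reversal n) y ⟩
  run (reversal n) (run (dual N) y)          ≡⟨ run-reversal (run (dual N) y) ⟩
  reverse (run (dual N) y)                   ≡⟨ cong (reverse ∘ run (dual N)) (negate-involutive y) ⟨
  reverse (run (dual N) (negate (negate y))) ≡⟨ cong reverse (run-dual N (negate y)) ⟩
  reverse (negate (run N (negate y)))        ∎
  where open ≡-Reasoning

Sorts-negationDual : {X Y : Subset n} →
  Y ⊆ X ∘ negate → (N : Network n) → Sorts N X → Sorts (negationDual N) Y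
Sorts-negationDual Y⊆Xᵇ N sortsX y y∈Y =
  subst Sorted (sym (run-negationDual N y)) (Sorted-reverse-negate (sortsX (negate y) (Y⊆Xᵇ y∈Y)))

Sorts-antitone : {X Y : Subset n} → Y ⊆ X → (N : Network n) → Sorts N X → Sorts N Y
Sorts-antitone Y⊆X N sortsX y y∈Y = sortsX y (Y⊆X y∈Y)

IsS-transfer : {X Y : Subset n} {k : ℕ} (f : Network n → Network n) → (∀ N → size (f N) ≡ size N) →
  (∀ N → Sorts N X → Sorts (f N) Y) → (∀ N → Sorts N Y → Sorts (f N) X) → IsS X k → IsS Y k
IsS-transfer {k = k} f size-f X→Y Y→X ((N , sortsX , size≡k) , minimal) =
  (f N , X→Y N sortsX , trans (size-f N) size≡k) ,
  λ M sortsY → subst (k ≤_) (size-f M) (minimal (f M) (Y→X M sortsY))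

IsS-⇔ : {X Y : Subset n} {k : ℕ} (f : Network n → Network n) → (∀ N → size (f N) ≡ size N) →
  (∀ N → Sorts N X → Sorts (f N) Y) → (∀ N → Sorts N Y → Sorts (f N) X) → IsS X k ⇔ IsS Y k
IsS-⇔ f size-f X→Y Y→X = mk⇔ (IsS-transfer f size-f X→Y Y→X) (IsS-transfer f size-f Y→X X→Y)

≐negSet⇒⊆ : {X Y : Subset n} → X ≐ negSet Y → X ⊆ Y ∘ negate
≐negSet⇒⊆ {Y = Y} X≐Yᵇ {x} x∈X with Equivalence.to (X≐Yᵇ x) x∈X
... | y , y∈Y , refl = subst Y (sym (negate-involutive y)) y∈Y

≐negSet⇒⊇ : {X Y : Subset n} → X ≐ negSet Y → Y ⊆ X ∘ negate
≐negSet⇒⊇ X≐Yᵇ {y} y∈Y = Equivalence.from (X≐Yᵇ (negate y)) (y , y∈Y , refl)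

mainTheorem12 : (n : ℕ) (X Y : Subset n) → NegSimilar X Y →
    (k : ℕ) → IsS X k ⇔ IsS Y k
mainTheorem12 n X Y (inj₁ X≐Y) k =
  IsS-⇔ id (λ _ → refl) (Sorts-antitone (Equivalence.from (X≐Y _))) (Sorts-antitone (Equivalence.to (X≐Y _)))
mainTheorem12 n X Y (inj₂ X≐Yᵇ) k =
  IsS-⇔ negationDual size-negationDual
    (Sorts-negationDual (≐negSet⇒⊇ X≐Yᵇ)) (Sorts-negationDual (≐negSet⇒⊆ X≐Yᵇ))
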